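{- Let $s,t\in 01*\overline{10}$ and let $\mathcal{H}$ be a sequence of $h$ hairpin deletion operations (or a sequence of $h$ hairpin completion operations) that transforms $s$ into $t$. For $i\in[1..h]$ let $S_i$ be the string obtained by applying the first $i$ operations of $\mathcal{H}$ to $s$. Then for every $i\in[1..h]$ we have $S_i[1]=0$ and $S_i[|S_i|]=\overline{0}$, and moreover $S_i[2]=1$ or $S_i[|S_i|-1]=\overline{1}$.
   Context: Strings are over $\{0,1\}$ with $\overline{0}=1$, $\overline{1}=0$; $\overline{X}$ applies the bar symbolwise and $\overleftarrow{X}=\overline{X[|X|]}\cdots\overline{X[1]}$. For strings $a,b$, $a*b$ denotes the set of strings of the form $a\cdot w\cdot b$ with $w$ arbitrary; so $01*\overline{10}$ is the set of strings beginning with $01$ and ending with $\overline{10}$. Hairpin deletion (modified definition): for a string $W$ and $\ell\in[1..\lfloor |W|/2\rfloor]$ with $W[1..\ell]=\overleftarrow{W[|W|-\ell+1..|W|]}$, a left deletion of length $\ell$ gives $W[\ell+1..|W|]$ and a right deletion gives $W[1..|W|-\ell]$. Hairpin completion (modified definition): a right completion of length $\ell\in[1..|W|]$ gives $W\cdot\overleftarrow{W[1..\ell]}$, a left completion gives $\overleftarrow{W[|W|-\ell+1..|W|]}\cdot W$. -}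

module Defs where

open import Data.Bool using (Bool; true; false; not)
open import Data.Nat using (ℕ; zero; suc; _+_; _∸_; _≤_; _/_)
open import Data.List using (List; []; _∷_; _++_; length; take; drop; reverse; map)
open import Data.Vec using (Vec; []; _∷_)
open import Data.Product using (Σ; ∃; _×_; _,_)
open import Data.Sum using (_⊎_)
open import Relation.Binary.PropositionalEquality using (_≡_)

-- Binary strings: the symbol 0 is `false`, 1 is `true`; overline is `not`.
Str : Set
Str = List Bool

bar : Bool → Bool
bar = not

revc : Str → Str
revc X = reverse (map not X)

-- 1-indexed access: X at i ≡ b  means 1 ≤ i ≤ |X| and X[i] = b.
data _at_≡_ : Str → ℕ → Bool → Set where
  here  : ∀ {b xs} → (b ∷ xs) at 1 ≡ b
  there : ∀ {x xs i b} → xs at suc i ≡ b → (x ∷ xs) at suc (suc i) ≡ b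

_∈_*_ : Str → Str → Str → Set
s ∈ a * b = Σ Str λ w → s ≡ a ++ w ++ b

zero1 : Str
zero1 = false ∷ true ∷ []

bar10 : Str
bar10 = map bar (true ∷ false ∷ [])

data HairpinDel (W : Str) : Str → Set where
  left  : (ℓ : ℕ) → 1 ≤ ℓ → ℓ ≤ length W / 2 →
          take ℓ W ≡ revc (drop (length W ∸ ℓ) W) →
          HairpinDel W (drop ℓ W)
  right : (ℓ : ℕ) → 1 ≤ ℓ → ℓ ≤ length W / 2 →
          take ℓ W ≡ revc (drop (length W ∸ ℓ) W) →
          HairpinDel W (take (length W ∸ ℓ) W)

data HairpinComp (W : Str) : Str → Set where
  right : (ℓ : ℕ) → 1 ≤ ℓ → ℓ ≤ length W →
          HairpinComp W (W ++ revc (take ℓ W))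
  left  : (ℓ : ℕ) → 1 ≤ ℓ → ℓ ≤ length W →
          HairpinComp W (revc (drop (length W ∸ ℓ) W) ++ W)

-- Run R s Ss t : the vector Ss = (S_1, …, S_h) of intermediate results of applying
-- h operations (each an R-step) to s, ending in t.
data Run (R : Str → Str → Set) : (s : Str) → {h : ℕ} → Vec Str h → Str → Set where
  done : ∀ {s} → Run R s [] s
  step : ∀ {s S₁ t h} {Ss : Vec Str h} → R s S₁ → Run R S₁ Ss t → Run R s (S₁ ∷ Ss) t

-- A hairpin deletion replaces W = A ++ M ++ revc A by A ++ M or by M ++ revc A, and a
-- hairpin completion is the reverse step. The sets 0*1 and 00*11 are inherited by W
-- from the shorter string: the kept arm fixes the symbols at one end of W, and revc
-- carries them, complemented, to the other end. Along deletions every S_i therefore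
-- lies in 0*1 because t does, and not in 00*11 because s would then lie there too;
-- along completions s and t swap roles. Finally, a string in 0*1 but not in 00*11 has
-- second symbol 1 or penultimate symbol 0.
module Submission where

open import Defs
open import Data.Bool using (true; false; not)
open import Data.Bool.Properties using (not-involutive)
open import Data.Empty using (⊥-elim)
open import Data.Fin using (Fin; zero; suc)
open import Data.List
  using (List; []; _∷_; _++_; [_]; _∷ʳ_; length; take; drop; reverse; map; initLast; _∷ʳ′_)
open import Data.List.Properties
  using (++-assoc; ++-identityʳ; ∷-injectiveˡ; ∷-injectiveʳ; take++drop≡id;
         map-++; map-∘; map-cong; map-id; reverse-++; reverse-map; reverse-involutive)
open import Data.Nat using (ℕ; zero; suc; _+_; _*_; _∸_; _/_; _≤_; s≤s)
open import Data.Nat.DivMod using (m/n*n≤m)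
open import Data.Nat.Properties using (≤-trans; *-comm; *-monoˡ-≤; +-identityʳ; m+n≤o⇒m≤o∸n)
open import Data.Product using (_×_; _,_)
open import Data.Sum using (_⊎_; inj₁; inj₂)
open import Data.Vec using (Vec; lookup)
open import Function using (_∘_)
open import Relation.Binary.Construct.Closure.ReflexiveTransitive using (Star; ε; _◅_; fold)
open import Relation.Binary.PropositionalEquality
  using (_≡_; refl; sym; trans; cong; cong₂; subst; subst₂; module ≡-Reasoning)
open import Relation.Nullary using (¬_)

private variable
  X W R : Str

revc-++ : ∀ X Y → revc (X ++ Y) ≡ revc Y ++ revc X
revc-++ X Y = trans (cong reverse (map-++ not X Y)) (reverse-++ (map not X) (map not Y))

revc-involutive : ∀ X → revc (revc X) ≡ X
revc-involutive X = begin
  reverse (map not (reverse (map not X))) ≡⟨ cong reverse (reverse-map not (map not X)) ⟩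
  reverse (reverse (map not (map not X))) ≡⟨ reverse-involutive _ ⟩
  map not (map not X)                     ≡⟨ map-∘ X ⟨
  map (not ∘ not) X                       ≡⟨ map-cong not-involutive X ⟩
  map (λ x → x) X                         ≡⟨ map-id X ⟩
  X                                       ∎
  where open ≡-Reasoning

revc-hairpin : ∀ A M → revc (A ++ M ++ revc A) ≡ A ++ revc M ++ revc A
revc-hairpin A M = begin
  revc (A ++ M ++ revc A)             ≡⟨ revc-++ A (M ++ revc A) ⟩
  revc (M ++ revc A) ++ revc A        ≡⟨ cong (_++ revc A) (revc-++ M (revc A)) ⟩
  (revc (revc A) ++ revc M) ++ revc A ≡⟨ cong (λ Z → (Z ++ revc M) ++ revc A) (revc-involutive A) ⟩
  (A ++ revc M) ++ revc A             ≡⟨ ++-assoc A (revc M) (revc A) ⟩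
  A ++ revc M ++ revc A               ∎
  where open ≡-Reasoning

take≡take++drop∘take : ∀ {A : Set} {ℓ k} (xs : List A) → ℓ ≤ k →
                       take k xs ≡ take ℓ xs ++ drop ℓ (take k xs)
take≡take++drop∘take {ℓ = zero}          xs       _       = refl
take≡take++drop∘take {ℓ = suc ℓ} {suc k} []       _       = refl
take≡take++drop∘take {ℓ = suc ℓ} {suc k} (x ∷ xs) (s≤s p) =
  cong (x ∷_) (take≡take++drop∘take xs p)

drop≡drop∘take++drop : ∀ {A : Set} {ℓ k} (xs : List A) → ℓ ≤ k →
                       drop ℓ xs ≡ drop ℓ (take k xs) ++ drop k xs
drop≡drop∘take++drop {ℓ = zero}  {k}     xs       _       = sym (take++drop≡id k xs)
drop≡drop∘take++drop {ℓ = suc ℓ} {suc k} []       _       = refl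
drop≡drop∘take++drop {ℓ = suc ℓ} {suc k} (x ∷ xs) (s≤s p) = drop≡drop∘take++drop xs p

≤/2⇒≤∸ : ∀ ℓ n → ℓ ≤ n / 2 → ℓ ≤ n ∸ ℓ
≤/2⇒≤∸ ℓ n ℓ≤n/2 =
  m+n≤o⇒m≤o∸n ℓ (subst (_≤ n) ℓ*2≡ℓ+ℓ (≤-trans (*-monoˡ-≤ 2 ℓ≤n/2) (m/n*n≤m n 2)))
  where
  ℓ*2≡ℓ+ℓ : ℓ * 2 ≡ ℓ + ℓ
  ℓ*2≡ℓ+ℓ = trans (*-comm ℓ 2) (cong (ℓ +_) (+-identityʳ ℓ))

revc-∈* : ∀ a b → X ∈ a * b → revc X ∈ revc b * revc a
revc-∈* a b (w , refl) = revc w , (begin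
  revc (a ++ w ++ b)           ≡⟨ revc-++ a (w ++ b) ⟩
  revc (w ++ b) ++ revc a      ≡⟨ cong (_++ revc a) (revc-++ w b) ⟩
  (revc b ++ revc w) ++ revc a ≡⟨ ++-assoc (revc b) (revc w) (revc a) ⟩
  revc b ++ revc w ++ revc a   ∎)
  where open ≡-Reasoning

∈*-shrink : ∀ a a′ b′ b → X ∈ a ++ a′ * (b′ ++ b) → X ∈ a * b
∈*-shrink a a′ b′ b (w , refl) = a′ ++ w ++ b′ , (begin
  (a ++ a′) ++ w ++ b′ ++ b ≡⟨ ++-assoc a a′ (w ++ b′ ++ b) ⟩
  a ++ a′ ++ w ++ b′ ++ b   ≡⟨ cong (λ Z → a ++ a′ ++ Z) (++-assoc w b′ b) ⟨
  a ++ a′ ++ (w ++ b′) ++ b ≡⟨ cong (a ++_) (++-assoc a′ (w ++ b′) b) ⟨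
  a ++ (a′ ++ w ++ b′) ++ b ∎)
  where open ≡-Reasoning

∈*-++ʳ : ∀ a b c → X ∈ a * b → (X ++ c) ∈ a * (b ++ c)
∈*-++ʳ a b c (w , refl) = w , (begin
  (a ++ w ++ b) ++ c ≡⟨ ++-assoc a (w ++ b) c ⟩
  a ++ (w ++ b) ++ c ≡⟨ cong (a ++_) (++-assoc w b c) ⟩
  a ++ w ++ b ++ c   ∎)
  where open ≡-Reasoning

hairpin-∈* : ∀ a (A M : Str) → ((a ++ A) ++ M ++ revc (a ++ A)) ∈ a * revc a
hairpin-∈* a A M =
  ∈*-shrink a A (revc A) (revc a) (subst (hairpin ∈ a ++ A *_) (revc-++ a A) (M , refl))
  where
  hairpin = (a ++ A) ++ M ++ revc (a ++ A)

zero0 one1 : Str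
zero0 = false ∷ [ false ]
one1  = true ∷ [ true ]

0*1 : Str → Set
0*1 W = W ∈ [ false ] * [ true ]

00*11 : Str → Set
00*11 W = W ∈ zero0 * one1

01*01⊆0*1 : X ∈ zero1 * bar10 → 0*1 X
01*01⊆0*1 = ∈*-shrink [ false ] [ true ] [ false ] [ true ]

01*01∉00*11 : X ∈ zero1 * bar10 → ¬ 00*11 X
01*01∉00*11 (_ , refl) (_ , ())

-- Unlike in HairpinDel, the arm A may be empty. A hairpin completion is the converse of a cut.
data HairpinCut : Str → Str → Set where
  cutˡ : ∀ A M → HairpinCut (A ++ M ++ revc A) (M ++ revc A)
  cutʳ : ∀ A M → HairpinCut (A ++ M ++ revc A) (A ++ M)

-- ℓ ≤ |W|/2 is what keeps the two arms of length ℓ apart.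
deletion-hairpin : ∀ W ℓ → ℓ ≤ length W / 2 → take ℓ W ≡ revc (drop (length W ∸ ℓ) W) →
  let A = take ℓ W ; M = drop ℓ (take (length W ∸ ℓ) W) in
  (W ≡ A ++ M ++ revc A) × (drop ℓ W ≡ M ++ revc A) × (take (length W ∸ ℓ) W ≡ A ++ M)
deletion-hairpin W ℓ ℓ≤n/2 arm = W≡A++M++Ā , drop≡M++Ā , take≡A++M
  where
  k = length W ∸ ℓ
  A = take ℓ W
  M = drop ℓ (take k W)
  ℓ≤k : ℓ ≤ k
  ℓ≤k = ≤/2⇒≤∸ ℓ (length W) ℓ≤n/2
  Ā≡B : revc A ≡ drop k W
  Ā≡B = trans (cong revc arm) (revc-involutive (drop k W))
  take≡A++M : take k W ≡ A ++ M
  take≡A++M = take≡take++drop∘take W ℓ≤k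
  drop≡M++Ā : drop ℓ W ≡ M ++ revc A
  drop≡M++Ā = trans (drop≡drop∘take++drop W ℓ≤k) (cong (M ++_) (sym Ā≡B))
  W≡A++M++Ā : W ≡ A ++ M ++ revc A
  W≡A++M++Ā = begin
    W                    ≡⟨ take++drop≡id k W ⟨
    take k W ++ drop k W ≡⟨ cong₂ _++_ take≡A++M (sym Ā≡B) ⟩
    (A ++ M) ++ revc A   ≡⟨ ++-assoc A M (revc A) ⟩
    A ++ M ++ revc A     ∎
    where open ≡-Reasoning

hairpinDel⇒cut : HairpinDel W R → HairpinCut W R
hairpinDel⇒cut {W} (left ℓ _ ℓ≤n/2 arm) with deletion-hairpin W ℓ ℓ≤n/2 arm
... | W≡ , drop≡ , _ = subst₂ HairpinCut (sym W≡) (sym drop≡) (cutˡ (take ℓ W) _)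
hairpinDel⇒cut {W} (right ℓ _ ℓ≤n/2 arm) with deletion-hairpin W ℓ ℓ≤n/2 arm
... | W≡ , _ , take≡ = subst₂ HairpinCut (sym W≡) (sym take≡) (cutʳ (take ℓ W) _)

hairpinComp⇒cut : HairpinComp W R → HairpinCut R W
hairpinComp⇒cut {W} (right ℓ _ _) = subst₂ HairpinCut R≡ W≡ (cutʳ A (drop ℓ W))
  where
  A = take ℓ W
  W≡ : A ++ drop ℓ W ≡ W
  W≡ = take++drop≡id ℓ W
  R≡ : A ++ drop ℓ W ++ revc A ≡ W ++ revc A
  R≡ = trans (sym (++-assoc A (drop ℓ W) (revc A))) (cong (_++ revc A) W≡)
hairpinComp⇒cut {W} (left ℓ _ _) = subst₂ HairpinCut (cong (A ++_) W≡) W≡ (cutˡ A (take k W))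
  where
  k = length W ∸ ℓ
  A = revc (drop k W)
  W≡ : take k W ++ revc A ≡ W
  W≡ = trans (cong (take k W ++_) (revc-involutive (drop k W))) (take++drop≡id k W)

-- A left cut is the mirror image under revc of a right cut.
cut-reflects : (P : Str → Set) → (∀ {X} → P X → P (revc X)) →
               (∀ A M → P (A ++ M) → P (A ++ M ++ revc A)) →
               HairpinCut W R → P R → P W
cut-reflects P P-revc P-cutʳ (cutʳ A M) = P-cutʳ A M
cut-reflects P P-revc P-cutʳ (cutˡ A M) pR =
  subst P mirror-long (P-revc (P-cutʳ A (revc M) (subst P mirror-short (P-revc pR))))
  where
  mirror-short : revc (M ++ revc A) ≡ A ++ revc M
  mirror-short = trans (revc-++ M (revc A)) (cong (_++ revc M) (revc-involutive A))
  mirror-long : revc (A ++ revc M ++ revc A) ≡ A ++ M ++ revc A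
  mirror-long = trans (revc-hairpin A (revc M)) (cong (λ Z → A ++ Z ++ revc A) (revc-involutive M))

cut-reflects-0*1 : HairpinCut W R → 0*1 R → 0*1 W
cut-reflects-0*1 = cut-reflects 0*1 (revc-∈* [ false ] [ true ]) cutʳ-reflects
  where
  cutʳ-reflects : ∀ A M → 0*1 (A ++ M) → 0*1 (A ++ M ++ revc A)
  cutʳ-reflects []      M p = subst 0*1 (sym (++-identityʳ M)) p
  cutʳ-reflects (a ∷ A) M (_ , e) with refl ← ∷-injectiveˡ e = hairpin-∈* [ false ] A M

cut-reflects-00*11 : HairpinCut W R → 00*11 R → 00*11 W
cut-reflects-00*11 = cut-reflects 00*11 (revc-∈* zero0 one1) cutʳ-reflects
  where
  cutʳ-reflects : ∀ A M → 00*11 (A ++ M) → 00*11 (A ++ M ++ revc A)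
  cutʳ-reflects []           M p = subst 00*11 (sym (++-identityʳ M)) p
  cutʳ-reflects (a ∷ [])     M p@(_ , e) with refl ← ∷-injectiveˡ e =
    ∈*-shrink zero0 [] [ true ] one1 (∈*-++ʳ zero0 one1 [ true ] p)
  cutʳ-reflects (a ∷ a′ ∷ A) M (_ , e)
    with refl ← ∷-injectiveˡ e | refl ← ∷-injectiveˡ (∷-injectiveʳ e) =
    hairpin-∈* zero0 A M

Star-preserves : ∀ {I : Set} {T : I → I → Set} (P : I → Set) →
                 (∀ {x y} → T x y → P x → P y) → ∀ {x y} → Star T x y → P x → P y
Star-preserves P preserve = fold (λ x y → P x → P y) (λ t k → k ∘ preserve t) (λ p → p)

Star-reflects : ∀ {I : Set} {T : I → I → Set} (P : I → Set) →
                (∀ {x y} → T x y → P y → P x) → ∀ {x y} → Star T x y → P y → P x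
Star-reflects P reflect = fold (λ x y → P y → P x) (λ t k → reflect t ∘ k) (λ p → p)

Run⇒Star : ∀ {T : Str → Str → Set} {s t h} {Ss : Vec Str h} → Run T s Ss t → Star T s t
Run⇒Star done       = ε
Run⇒Star (step t r) = t ◅ Run⇒Star r

lookup-between : ∀ {T : Str → Str → Set} {s t h} {Ss : Vec Str h} → Run T s Ss t →
                 (i : Fin h) → Star T s (lookup Ss i) × Star T (lookup Ss i) t
lookup-between (step t r) zero    = t ◅ ε , Run⇒Star r
lookup-between (step t r) (suc i) with lookup-between r i
... | before , after = t ◅ before , after

length-∷ʳ : ∀ (X : Str) x → length (X ∷ʳ x) ≡ suc (length X)
length-∷ʳ []      x = refl
length-∷ʳ (y ∷ X) x = cong suc (length-∷ʳ X x)

at-++ : ∀ {X i x} Y → X at i ≡ x → (X ++ Y) at i ≡ x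
at-++ Y here      = here
at-++ Y (there p) = there (at-++ Y p)

∷ʳ-at : ∀ (X : Str) x → (X ∷ʳ x) at suc (length X) ≡ x
∷ʳ-at []      x = here
∷ʳ-at (y ∷ X) x = there (∷ʳ-at X x)

at-last : ∀ (X : Str) x → (X ∷ʳ x) at length (X ∷ʳ x) ≡ x
at-last X x = subst (λ i → (X ∷ʳ x) at i ≡ x) (sym (length-∷ʳ X x)) (∷ʳ-at X x)

at-penultimate : ∀ (X : Str) x y → ((X ∷ʳ x) ∷ʳ y) at (length ((X ∷ʳ x) ∷ʳ y) ∸ 1) ≡ x
at-penultimate X x y =
  subst (λ i → ((X ∷ʳ x) ∷ʳ y) at i ≡ x) (sym length∸1) (at-++ [ y ] (∷ʳ-at X x))
  where
  length∸1 : length ((X ∷ʳ x) ∷ʳ y) ∸ 1 ≡ suc (length X)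
  length∸1 = trans (cong (_∸ 1) (length-∷ʳ (X ∷ʳ x) y)) (length-∷ʳ X x)

0*1∖00*11-second-or-penultimate : ∀ w → let W = (false ∷ w) ∷ʳ true in
  ¬ 00*11 W → (W at 2 ≡ true) ⊎ (W at (length W ∸ 1) ≡ false)
0*1∖00*11-second-or-penultimate []          _ = inj₁ (there here)
0*1∖00*11-second-or-penultimate (true ∷ w)  _ = inj₁ (there here)
0*1∖00*11-second-or-penultimate (false ∷ w) W∉00*11 with initLast w
... | []           = inj₂ (at-penultimate [ false ] false true)
... | w′ ∷ʳ′ false = inj₂ (at-penultimate (false ∷ false ∷ w′) false true)
... | w′ ∷ʳ′ true  =
  ⊥-elim (W∉00*11 (w′ , cong (λ Z → false ∷ false ∷ Z) (++-assoc w′ [ true ] [ true ])))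

0*1∖00*11-boundary : 0*1 W → ¬ 00*11 W →
  (W at 1 ≡ false) × (W at length W ≡ bar false) ×
  ((W at 2 ≡ true) ⊎ (W at (length W ∸ 1) ≡ bar true))
0*1∖00*11-boundary (w , refl) W∉00*11 =
  here , at-last (false ∷ w) true , 0*1∖00*11-second-or-penultimate w W∉00*11

corollary14 : ∀ (s t : Str) → s ∈ zero1 * bar10 → t ∈ zero1 * bar10 →
    ∀ (h : ℕ) (Ss : Vec Str h) → Run HairpinDel s Ss t ⊎ Run HairpinComp s Ss t →
    ∀ (i : Fin h) →
      (lookup Ss i at 1 ≡ false) ×
      (lookup Ss i at length (lookup Ss i) ≡ bar false) ×
      ((lookup Ss i at 2 ≡ true) ⊎ (lookup Ss i at (length (lookup Ss i) ∸ 1) ≡ bar true))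
corollary14 s t s∈ t∈ h Ss (inj₁ deletions) i with lookup-between deletions i
... | before , after =
  0*1∖00*11-boundary
    (Star-reflects 0*1 (cut-reflects-0*1 ∘ hairpinDel⇒cut) after (01*01⊆0*1 t∈))
    (01*01∉00*11 s∈ ∘ Star-reflects 00*11 (cut-reflects-00*11 ∘ hairpinDel⇒cut) before)
corollary14 s t s∈ t∈ h Ss (inj₂ completions) i with lookup-between completions i
... | before , after =
  0*1∖00*11-boundary
    (Star-preserves 0*1 (cut-reflects-0*1 ∘ hairpinComp⇒cut) before (01*01⊆0*1 s∈))
    (01*01∉00*11 t∈ ∘ Star-preserves 00*11 (cut-reflects-00*11 ∘ hairpinComp⇒cut) after)
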